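{- The inference rule ($\omega$) is admissible in $\mathsf{K}^+$: for any formulas $A$ and $B_0,B_1,B_2,\dots$, if $\mathsf{K}^+\vdash B_i\to\Box(A\wedge B_{i+1})$ for every $i\in\mathbb{N}$, then $\mathsf{K}^+\vdash B_0\to\Box^+A$.
   Context: Formulas are built from propositional variables $p_0,p_1,\dots$ and $\bot$ by $\to$, $\Box$, $\Box^+$ ($\neg A:=A\to\bot$, $A\wedge B:=\neg(A\to\neg B)$, $A\vee B:=\neg A\to B$). The logic $\mathsf{K}^+$ is given by axioms: all classical propositional tautologies; $\Box(A\to B)\to(\Box A\to\Box B)$; $\Box^+(A\to B)\to(\Box^+A\to\Box^+B)$; $\Box^+A\to\Box A\wedge\Box\Box^+A$; $\Box A\wedge\Box^+(A\to\Box A)\to\Box^+A$; and rules modus ponens (from $A$ and $A\to B$ infer $B$) and ($\mathsf{nec}$) from $A$ infer $\Box^+A$. $\mathsf{K}^+\vdash A$ means $A$ is derivable (by a finite derivation) in this calculus. -}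

module Defs where

open import Data.Nat using (ℕ; suc)
open import Data.Bool using (Bool; true; false; _∧_; _∨_; not)
open import Relation.Binary.PropositionalEquality using (_≡_)

infixr 5 _⇒_

data Fm : Set where
  var  : ℕ → Fm
  ⊥'   : Fm
  _⇒_  : Fm → Fm → Fm
  □    : Fm → Fm
  □⁺   : Fm → Fm

¬' : Fm → Fm
¬' A = A ⇒ ⊥'

_∧'_ : Fm → Fm → Fm
A ∧' B = ¬' (A ⇒ ¬' B)

_∨'_ : Fm → Fm → Fm
A ∨' B = ¬' A ⇒ B

eval : (ℕ → Bool) → (Fm → Bool) → Fm → Bool
eval v w (var n) = v n
eval v w ⊥' = false
eval v w (A ⇒ B) = not (eval v w A) ∨ eval v w B
eval v w (□ A) = w (□ A)
eval v w (□⁺ A) = w (□⁺ A)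

-- A is a classical propositional tautology (instance of a tautology
-- with modalised subformulas as atoms)
Tautology : Fm → Set
Tautology A = (v : ℕ → Bool) (w : Fm → Bool) → eval v w A ≡ true

data ⊢_ : Fm → Set where
  taut   : ∀ {A} → Tautology A → ⊢ A
  K□     : ∀ {A B} → ⊢ (□ (A ⇒ B) ⇒ (□ A ⇒ □ B))
  K□⁺    : ∀ {A B} → ⊢ (□⁺ (A ⇒ B) ⇒ (□⁺ A ⇒ □⁺ B))
  unfold : ∀ {A} → ⊢ (□⁺ A ⇒ (□ A ∧' □ (□⁺ A)))
  ind    : ∀ {A} → ⊢ ((□ A ∧' □⁺ (A ⇒ □ A)) ⇒ □⁺ A)
  mp     : ∀ {A B} → ⊢ A → ⊢ (A ⇒ B) → ⊢ B
  nec    : ∀ {A} → ⊢ A → ⊢ □⁺ A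

-- Admissibility is proved semantically. In a finite Kripke model, □⁺ A holds at a world when A
-- holds at every world reachable in one or more steps, i.e. □⁺ A is the greatest solution of
-- Z = □ (A ∧ Z); K⁺ is sound for this reading. If every premise is valid, then B i at a world
-- forces A ∧ B (suc i) at every successor, so the worlds satisfying A and some B i form a
-- successor-closed set, and by coinduction B 0 forces □⁺ A.
--
-- It remains to derive a formula G that is valid in all finite models. The worlds of the
-- canonical model are the Boolean assignments to the closure of G, each described by the
-- conjunction χ of its literals. Worlds that are locally incoherent with the remaining ones are
-- deleted until nothing changes, and every deleted world is refuted, ⊢ ¬ χ. For a world making
-- □⁺ A false although A holds forever from each of its live successors, the refutation applies
-- the induction axiom to the disjunction of χ over the worlds from which A holds forever. On the
-- surviving worlds truth agrees with the assignment, and since the disjunction of all χ is a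
-- tautology, G is derivable.

module Submission where

open import Defs
open import Data.Bool using (Bool; true; false; T; not; _∧_; _∨_; if_then_else_)
open import Data.Bool.ListAction using (all)
open import Data.Bool.Properties using (T-≡; T-not-≡; T-∧; T-∨) renaming (_≟_ to _≟ᵇ_)
open import Data.Empty using (⊥-elim)
open import Data.Fin using (Fin)
open import Data.Fin.Subset using (∣_∣) renaming (_∈_ to _∈ₛ_)
open import Data.Fin.Subset.Properties using (p⊂q⇒∣p∣<∣q∣; x∈p⇒∣p-x∣<∣p∣; ∣p∣≤n)
open import Data.List using (List; []; _∷_; _++_; foldr; map; allFin; filter; length; lookup)
open import Data.List.Membership.Propositional using (_∈_; find; lose)
open import Data.List.Membership.Propositional.Properties
  using (∈-allFin; ∈-map⁺; ∈-map⁻; ∈-filter⁺; ∈-filter⁻; ∈-lookup; ∈-++⁺ˡ; ∈-++⁺ʳ; ∈-++⁻)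
open import Data.List.Relation.Binary.Subset.Propositional using (_⊆_)
open import Data.List.Relation.Unary.All as All using (All; []; _∷_)
open import Data.List.Relation.Unary.All.Properties using (all⁺; all⁻; ¬All⇒Any¬; map⁺; map⁻)
open import Data.List.Relation.Unary.Any using (Any; here; there; index)
open import Data.List.Relation.Unary.Any.Properties using (lookup-index)
open import Data.Nat using (ℕ; zero; suc; _<_; _≤_; z≤n; s≤s) renaming (_≟_ to _≟ℕ_)
open import Data.Nat.Properties using (<-≤-trans; <-irrefl; ≤-pred; ≤-trans)
open import Data.Product using (_×_; _,_; ∃; proj₁; proj₂)
open import Data.Sum using (_⊎_; inj₁; inj₂; [_,_]′)
open import Data.Unit using (⊤; tt)
open import Data.Vec using (tabulate)
open import Data.Vec.Properties using (lookup∘tabulate; lookup⇒[]=; []=⇒lookup)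
open import Function using (_∘_; id; case_of_; Equivalence)
open import Relation.Binary.Definitions using (DecidableEquality)
open import Relation.Binary.PropositionalEquality
  using (_≡_; refl; subst; sym; trans; cong; cong₂; module ≡-Reasoning)
open import Relation.Nullary using (¬_; yes; no)
open import Relation.Nullary.Decidable using (T?; map′; _×-dec_; isYes; fromWitness; toWitness)

-- Classical two-valued semantics

infixr 5 _→ᵇ_

_→ᵇ_ : Bool → Bool → Bool
a →ᵇ b = not a ∨ b

→ᵇ-intro : ∀ {a b} → (T a → T b) → T (a →ᵇ b)
→ᵇ-intro {false} f = _
→ᵇ-intro {true}  f = f _

→ᵇ-elim : ∀ {a b} → T (a →ᵇ b) → T a → T b
→ᵇ-elim {true} ab _ = ab

→ᵇ-counterexample : ∀ {a b} → ¬ T (a →ᵇ b) → T a × ¬ T b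
→ᵇ-counterexample {false} n = ⊥-elim (n _)
→ᵇ-counterexample {true}  n = _ , n

¬T⇒≡false : ∀ {b} → ¬ T b → b ≡ false
¬T⇒≡false {false} _  = refl
¬T⇒≡false {true}  ¬b = ⊥-elim (¬b _)

¬T-∨ : ∀ {a b} → ¬ T (a ∨ b) → ¬ T a × ¬ T b
¬T-∨ {true}  ¬a∨b = ⊥-elim (¬a∨b _)
¬T-∨ {false} ¬a∨b = (λ ()) , ¬a∨b

¬T-∧ : ∀ {a b} → ¬ T (a ∧ b) → ¬ T a ⊎ ¬ T b
¬T-∧ {true}  ¬a∧b = inj₂ ¬a∧b
¬T-∧ {false} _    = inj₁ λ ()

¬T-not : ∀ {a} → ¬ T (not a) → T a
¬T-not {true}  _   = _
¬T-not {false} ¬¬a = ⊥-elim (¬¬a _)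

T-not : ∀ {a} → T (not a) → ¬ T a
T-not {false} _ ()

T-injective : ∀ {a b} → (T a → T b) → (T b → T a) → a ≡ b
T-injective {false} {false} _ _ = refl
T-injective {false} {true}  _ b⇒a = ⊥-elim (b⇒a _)
T-injective {true}  {false} a⇒b _ = ⊥-elim (a⇒b _)
T-injective {true}  {true}  _ _ = refl

-- Boolean evaluations that are classical on ⊥' and ⇒. Two-valued evaluations and the worlds of
-- a Kripke model are both of this kind, so one set of natural-deduction rules serves for both.
record Valuation : Set where
  field
    value   : Fm → Bool
    value-⊥ : value ⊥' ≡ false
    value-⇒ : ∀ A B → value (A ⇒ B) ≡ value A →ᵇ value B

open Valuation

infix 4 _⊨_

-- A record rather than T (value ρ A), so that A is recoverable from the type.
record _⊨_ (ρ : Valuation) (A : Fm) : Set where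
  constructor holds
  field truth : T (value ρ A)

open _⊨_

two-valued : (ℕ → Bool) → (Fm → Bool) → Valuation
two-valued v w = record { value = eval v w ; value-⊥ = refl ; value-⇒ = λ _ _ → refl }

module _ {ρ : Valuation} where

  ⇒I : ∀ {A B} → (ρ ⊨ A → ρ ⊨ B) → ρ ⊨ A ⇒ B
  ⇒I {A} {B} f = holds (subst T (sym (value-⇒ ρ A B)) (→ᵇ-intro (truth ∘ f ∘ holds)))

  ⇒E : ∀ {A B} → ρ ⊨ A ⇒ B → ρ ⊨ A → ρ ⊨ B
  ⇒E {A} {B} (holds ab) (holds a) = holds (→ᵇ-elim (subst T (value-⇒ ρ A B) ab) a)

  ⊥E : ¬ (ρ ⊨ ⊥')
  ⊥E (holds f) = subst T (value-⊥ ρ) f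

  excluded-middle : ∀ A → ρ ⊨ A ⊎ ρ ⊨ ¬' A
  excluded-middle A with T? (value ρ A)
  ... | yes a = inj₁ (holds a)
  ... | no ¬a = inj₂ (⇒I (⊥-elim ∘ ¬a ∘ truth))

  ¬I : ∀ {A} → ¬ (ρ ⊨ A) → ρ ⊨ ¬' A
  ¬I ¬a = ⇒I (⊥-elim ∘ ¬a)

  ¬E : ∀ {A} → ρ ⊨ ¬' A → ¬ (ρ ⊨ A)
  ¬E na = ⊥E ∘ ⇒E na

  raa : ∀ {A} → ¬ (ρ ⊨ ¬' A) → ρ ⊨ A
  raa {A} ¬na with excluded-middle A
  ... | inj₁ a  = a
  ... | inj₂ na = ⊥-elim (¬na na)

  ∧I : ∀ {A B} → ρ ⊨ A → ρ ⊨ B → ρ ⊨ A ∧' B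
  ∧I a b = ⇒I λ a⇒¬b → ⇒E (⇒E a⇒¬b a) b

  ∧E₁ : ∀ {A B} → ρ ⊨ A ∧' B → ρ ⊨ A
  ∧E₁ ab = raa λ na → ¬E ab (⇒I (⊥-elim ∘ ¬E na))

  ∧E₂ : ∀ {A B} → ρ ⊨ A ∧' B → ρ ⊨ B
  ∧E₂ ab = raa λ nb → ¬E ab (⇒I λ _ → nb)

  ∨I₁ : ∀ {A B} → ρ ⊨ A → ρ ⊨ A ∨' B
  ∨I₁ a = ⇒I λ na → ⊥-elim (¬E na a)

  ∨I₂ : ∀ {A B} → ρ ⊨ B → ρ ⊨ A ∨' B
  ∨I₂ b = ⇒I λ _ → b

  ∨E : ∀ {A B} → ρ ⊨ A ∨' B → ρ ⊨ A ⊎ ρ ⊨ B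
  ∨E {A} ab with excluded-middle A
  ... | inj₁ a  = inj₁ a
  ... | inj₂ na = inj₂ (⇒E ab na)

⊤' : Fm
⊤' = ¬' ⊥'

⋀ : List Fm → Fm
⋀ = foldr _∧'_ ⊤'

⋁ : List Fm → Fm
⋁ = foldr _∨'_ ⊥'

module _ {ρ : Valuation} where

  ⋀I : ∀ {As} → All (ρ ⊨_) As → ρ ⊨ ⋀ As
  ⋀I []       = ¬I ⊥E
  ⋀I (a ∷ as) = ∧I a (⋀I as)

  ⋀E : ∀ {As} → ρ ⊨ ⋀ As → All (ρ ⊨_) As
  ⋀E {[]}     _  = []
  ⋀E {A ∷ As} as = ∧E₁ as ∷ ⋀E (∧E₂ as)

  ⋁I : ∀ {As} → Any (ρ ⊨_) As → ρ ⊨ ⋁ As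
  ⋁I (here a)   = ∨I₁ a
  ⋁I (there as) = ∨I₂ (⋁I as)

-- Derived rules of K⁺

infixr 5 _⇒*_

_⇒*_ : List Fm → Fm → Fm
Hs ⇒* G = foldr _⇒_ G Hs

tautological : ∀ {Hs G} → All ⊢_ Hs → (∀ {ρ} → All (ρ ⊨_) Hs → ρ ⊨ G) → ⊢ G
tautological {Hs} {G} ⊢Hs entails =
  discharge ⊢Hs (taut λ v w → Equivalence.to T-≡ (truth (curried {two-valued v w} entails)))
  where
  curried : ∀ {ρ Hs} → (All (ρ ⊨_) Hs → ρ ⊨ G) → ρ ⊨ Hs ⇒* G
  curried {Hs = []}     f = f []
  curried {Hs = H ∷ Hs} f = ⇒I λ h → curried (f ∘ (h ∷_))
  discharge : ∀ {Hs} → All ⊢_ Hs → ⊢ (Hs ⇒* G) → ⊢ G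
  discharge []          d = d
  discharge (⊢H ∷ ⊢Hs) d = discharge ⊢Hs (mp ⊢H d)

⇒-trans : ∀ {A B C} → ⊢ (A ⇒ B) → ⊢ (B ⇒ C) → ⊢ (A ⇒ C)
⇒-trans ab bc = tautological (ab ∷ bc ∷ []) λ { (f ∷ g ∷ []) → ⇒I (⇒E g ∘ ⇒E f) }

explosion : ∀ {A B} → ⊢ (¬' A) → ⊢ (A ⇒ B)
explosion ⊢¬A = tautological (⊢¬A ∷ []) λ { (na ∷ []) → ⇒I (⊥-elim ∘ ¬E na) }

refutation : ∀ {A B} → ⊢ (A ⇒ B) → ⊢ (A ⇒ ¬' B) → ⊢ (¬' A)
refutation ab a¬b = tautological (ab ∷ a¬b ∷ []) λ { (f ∷ g ∷ []) → ¬I λ a → ¬E (⇒E g a) (⇒E f a) }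

⋁-elim : ∀ {As G} → (∀ {A} → A ∈ As → ⊢ (A ⇒ G)) → ⊢ (⋁ As ⇒ G)
⋁-elim {[]}     _    = tautological [] λ _ → ⇒I (⊥-elim ∘ ⊥E)
⋁-elim {A ∷ As} ⊢A⇒G = tautological (⊢A⇒G (here refl) ∷ ⋁-elim (⊢A⇒G ∘ there) ∷ []) λ where
  (f ∷ g ∷ []) → ⇒I λ a∨as → [ ⇒E f , ⇒E g ]′ (∨E a∨as)

□-nec : ∀ {A} → ⊢ A → ⊢ (□ A)
□-nec ⊢A = tautological (nec ⊢A ∷ unfold ∷ []) λ { (a ∷ u ∷ []) → ∧E₁ (⇒E u a) }

□-mono : ∀ {A B} → ⊢ (A ⇒ B) → ⊢ (□ A ⇒ □ B)
□-mono ⊢A⇒B = mp (□-nec ⊢A⇒B) K□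

□-∧ : ∀ {A B} → ⊢ (□ A ∧' □ B ⇒ □ (A ∧' B))
□-∧ {A} {B} = tautological (□-mono pair ∷ K□ ∷ []) λ
  { (f ∷ k ∷ []) → ⇒I λ c → ⇒E (⇒E k (⇒E f (∧E₁ c))) (∧E₂ c) }
  where
  pair : ⊢ (A ⇒ B ⇒ A ∧' B)
  pair = tautological [] λ _ → ⇒I λ a → ⇒I λ b → ∧I a b

□-⋀ : ∀ As → ⊢ (⋀ (map □ As) ⇒ □ (⋀ As))
□-⋀ []       = tautological (□-nec (tautological [] λ _ → ⋀I []) ∷ []) λ { (b ∷ []) → ⇒I λ _ → b }
□-⋀ (A ∷ As) = tautological (□-⋀ As ∷ □-∧ ∷ []) λ where
  (ih ∷ k ∷ []) → ⇒I λ c → ⇒E k (∧I (∧E₁ c) (⇒E ih (∧E₂ c)))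

□-regular : ∀ {As B} → ⊢ (⋀ As ⇒ B) → ⊢ (⋀ (map □ As) ⇒ □ B)
□-regular {As} ⊢⋀As⇒B = ⇒-trans (□-⋀ As) (□-mono ⊢⋀As⇒B)

□⁺-induction : ∀ {I X} → ⊢ (I ⇒ X) → ⊢ (I ⇒ □ I) → ⊢ (□ I ⇒ □⁺ X)
□⁺-induction ⊢I⇒X ⊢I⇒□I = tautological (ind ∷ nec ⊢I⇒□I ∷ K□⁺ ∷ nec ⊢I⇒X ∷ []) λ where
  (i ∷ inv ∷ k ∷ b ∷ []) → ⇒I λ □I → ⇒E (⇒E k b) (⇒E i (∧I □I inv))

□⁺⇒□ : ∀ {A} → ⊢ (□⁺ A ⇒ □ A)
□⁺⇒□ = tautological (unfold ∷ []) λ { (u ∷ []) → ⇒I (∧E₁ ∘ ⇒E u) }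

□⁺⇒□□⁺ : ∀ {A} → ⊢ (□⁺ A ⇒ □ (□⁺ A))
□⁺⇒□□⁺ = tautological (unfold ∷ []) λ { (u ∷ []) → ⇒I (∧E₂ ∘ ⇒E u) }

-- Finite search and iterated deletion

module _ {X : Set} {p : X → Bool} where

  all-intro : ∀ {xs} → (∀ {x} → x ∈ xs → T (p x)) → T (all p xs)
  all-intro f = all⁻ p (All.tabulate f)

  all-elim : ∀ {xs x} → T (all p xs) → x ∈ xs → T (p x)
  all-elim {xs} ps = All.lookup (all⁺ p xs ps)

  all-counterexample : ∀ {xs} → ¬ T (all p xs) → ∃ λ x → x ∈ xs × ¬ T (p x)
  all-counterexample {xs} ¬ps = find (¬All⇒Any¬ (T? ∘ p) xs (¬ps ∘ all⁻ p))

every : ∀ {n} → (Fin n → Bool) → Bool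
every {n} p = all p (allFin n)

module _ {n : ℕ} {p : Fin n → Bool} where

  every-intro : (∀ i → T (p i)) → T (every p)
  every-intro f = all-intro {xs = allFin n} λ {i} _ → f i

  every-elim : T (every p) → ∀ i → T (p i)
  every-elim ps i = all-elim ps (∈-allFin i)

  every-counterexample : ¬ T (every p) → ∃ λ i → ¬ T (p i)
  every-counterexample ¬ps with all-counterexample {xs = allFin n} ¬ps
  ... | i , _ , ¬pi = i , ¬pi

module Iterated-deletion {N : ℕ} (h : (Fin N → Bool) → Fin N → Bool) where

  shrink : (Fin N → Bool) → Fin N → Bool
  shrink C i = C i ∧ h C i

  stable : (Fin N → Bool) → Bool
  stable C = every λ i → C i →ᵇ h C i

  iterate : ℕ → (Fin N → Bool) → Fin N → Bool
  iterate zero    C = C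
  iterate (suc n) C = if stable C then C else iterate n (shrink C)

  -- Every unstable round deletes a point, so after N rounds h holds at every survivor.
  survivors : (Fin N → Bool) → Fin N → Bool
  survivors = iterate N

  survivors-invariant : (P : (Fin N → Bool) → Set) → (∀ {C} → P C → P (shrink C)) →
                        ∀ {C} → P C → P (survivors C)
  survivors-invariant P step = go N
    where
    go : ∀ n {C} → P C → P (iterate n C)
    go zero    pc = pc
    go (suc n) {C} pc with stable C
    ... | true  = pc
    ... | false = go n (step pc)

  private
    size : (Fin N → Bool) → ℕ
    size C = ∣ tabulate C ∣

    ∈-tabulate⁺ : ∀ (C : Fin N → Bool) {i} → T (C i) → i ∈ₛ tabulate C
    ∈-tabulate⁺ C {i} ci =
      lookup⇒[]= i (tabulate C) (trans (lookup∘tabulate C i) (Equivalence.to T-≡ ci))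

    ∈-tabulate⁻ : ∀ (C : Fin N → Bool) {i} → i ∈ₛ tabulate C → T (C i)
    ∈-tabulate⁻ C {i} i∈C = Equivalence.from T-≡ (trans (sym (lookup∘tabulate C i)) ([]=⇒lookup i∈C))

    size-pos : ∀ {C i} → T (C i) → 0 < size C
    size-pos {C} ci = ≤-trans (s≤s z≤n) (x∈p⇒∣p-x∣<∣p∣ {p = tabulate C} (∈-tabulate⁺ C ci))

    shrink-split : ∀ {C i} → T (shrink C i) → T (C i) × T (h C i)
    shrink-split {C} {i} = Equivalence.to (T-∧ {C i})

    size-shrink : ∀ {C i} → T (C i) → ¬ T (h C i) → size (shrink C) < size C
    size-shrink {C} {i} ci ¬hci = p⊂q⇒∣p∣<∣q∣ {p = tabulate (shrink C)} {q = tabulate C}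
      ( (λ {x} x∈ → ∈-tabulate⁺ C (proj₁ (shrink-split {C} {x} (∈-tabulate⁻ (shrink C) x∈))))
      , i , ∈-tabulate⁺ C ci , ¬hci ∘ proj₂ ∘ shrink-split {C} {i} ∘ ∈-tabulate⁻ (shrink C) )

    iterate-post-fixed : ∀ n C {i} → size C ≤ n → T (iterate n C i) → T (h (iterate n C) i)
    iterate-post-fixed zero C size≤0 ci = ⊥-elim (<-irrefl refl (<-≤-trans (size-pos {C} ci) size≤0))
    iterate-post-fixed (suc n) C {i} size≤ ci with stable C in eq
    ... | true  = →ᵇ-elim (every-elim (subst T (sym eq) _) i) ci
    ... | false with every-counterexample {p = λ j → C j →ᵇ h C j} (subst T eq)
    ...   | j , ¬ok with →ᵇ-counterexample ¬ok
    ...     | cj , ¬hcj =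
      iterate-post-fixed n (shrink C) (≤-pred (<-≤-trans (size-shrink {C} cj ¬hcj) size≤)) ci

  survivors-post-fixed : ∀ C {i} → T (survivors C i) → T (h (survivors C) i)
  survivors-post-fixed C = iterate-post-fixed N C (∣p∣≤n (tabulate C))

-- Finite Kripke models

module Frame {N : ℕ} (R : Fin N → Fin N → Bool) (S : Fin N → Bool) where

  Step : Fin N → Fin N → Set
  Step j k = T (S k) × T (R j k)

  □[_] : (Fin N → Bool) → Fin N → Bool
  □[ P ] j = every λ k → S k ∧ R j k →ᵇ P k

  □-intro : ∀ {P j} → (∀ {k} → Step j k → T (P k)) → T (□[ P ] j)
  □-intro {P} {j} f = every-intro λ k → →ᵇ-intro (f ∘ Equivalence.to (T-∧ {S k}))

  □-elim : ∀ {P j k} → T (□[ P ] j) → Step j k → T (P k)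
  □-elim {P} {j} {k} □P step = →ᵇ-elim (every-elim □P k) (Equivalence.from (T-∧ {S k}) step)

  -- The greatest set of live P-worlds closed under Step: the worlds where P holds from now on.
  □*[_] : (Fin N → Bool) → Fin N → Bool
  □*[ P ] = survivors λ k → S k ∧ P k
    where open Iterated-deletion □[_]

  module _ {P : Fin N → Bool} where
    open Iterated-deletion □[_]

    □*-now : ∀ {k} → T (□*[ P ] k) → T (S k) × T (P k)
    □*-now = survivors-invariant (λ C → ∀ {k} → T (C k) → T (S k) × T (P k))
      (λ {C} ih {k} → ih ∘ proj₁ ∘ Equivalence.to (T-∧ {C k}))
      (λ {k} → Equivalence.to (T-∧ {S k}))

    □*-next : ∀ {k m} → T (□*[ P ] k) → Step k m → T (□*[ P ] m)
    □*-next = □-elim ∘ survivors-post-fixed _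

    □*-coinduction : (D : Fin N → Set) → (∀ {k} → D k → T (S k) × T (P k)) →
                     (∀ {k m} → D k → Step k m → D m) → ∀ {k} → D k → T (□*[ P ] k)
    □*-coinduction D D⊆SP D-closed = survivors-invariant (λ C → ∀ {k} → D k → T (C k))
      (λ {C} D⊆C {k} dk → Equivalence.from (T-∧ {C k}) (D⊆C dk , □-intro (D⊆C ∘ D-closed dk)))
      (λ {k} → Equivalence.from (T-∧ {S k}) ∘ D⊆SP)

module Model {N : ℕ} (V : Fin N → ℕ → Bool) (R : Fin N → Fin N → Bool) (S : Fin N → Bool) where
  open Frame R S public

  Sat : Fin N → Fm → Bool
  Sat j (var n)  = V j n
  Sat j ⊥'       = false
  Sat j (A ⇒ B)  = Sat j A →ᵇ Sat j B
  Sat j (□ A)    = □[ (λ k → Sat k A) ] j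
  Sat j (□⁺ A)   = □[ □*[ (λ k → Sat k A) ] ] j

  world : Fin N → Valuation
  world j = record { value = Sat j ; value-⊥ = refl ; value-⇒ = λ _ _ → refl }

  infix 4 _⊩_

  _⊩_ : Fin N → Fm → Set
  j ⊩ A = world j ⊨ A

  Sat-eval : ∀ j A → Sat j A ≡ eval (V j) (Sat j) A
  Sat-eval j (var n) = refl
  Sat-eval j ⊥'      = refl
  Sat-eval j (A ⇒ B) = cong₂ _→ᵇ_ (Sat-eval j A) (Sat-eval j B)
  Sat-eval j (□ A)   = refl
  Sat-eval j (□⁺ A)  = refl

  ⊩□-intro : ∀ {j A} → (∀ {k} → Step j k → k ⊩ A) → j ⊩ □ A
  ⊩□-intro f = holds (□-intro (truth ∘ f))

  ⊩□-elim : ∀ {j k A} → j ⊩ □ A → Step j k → k ⊩ A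
  ⊩□-elim (holds □A) step = holds (□-elim □A step)

  infix 4 _⊩*_

  _⊩*_ : Fin N → Fm → Set
  k ⊩* A = k ⊩ A × k ⊩ □⁺ A

  ⊩□⁺-step : ∀ {j k A} → j ⊩ □⁺ A → Step j k → k ⊩* A
  ⊩□⁺-step (holds □⁺A) step =
    holds (proj₂ (□*-now (□-elim □⁺A step))) , holds (□-intro (□*-next (□-elim □⁺A step)))

  ⊩□⁺-coinduction : ∀ {j A} (D : Fin N → Set) → (∀ {k} → D k → k ⊩ A) →
                    (∀ {k m} → D k → Step k m → D m) → (∀ {k} → Step j k → D k) → j ⊩ □⁺ A
  ⊩□⁺-coinduction D D⊩A D-closed start = holds (□-intro λ step →
    □*-coinduction (λ k → D k × T (S k)) (λ (dk , sk) → sk , truth (D⊩A dk))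
      (λ (dk , _) step′ → D-closed dk step′ , proj₁ step′) (start step , proj₁ step))

  soundness : ∀ {A} → ⊢ A → ∀ j → j ⊩ A
  soundness (taut {A} t) j =
    holds (subst T (sym (Sat-eval j A)) (Equivalence.from T-≡ (t (V j) (Sat j))))
  soundness K□ j = ⇒I λ □A⇒B → ⇒I λ □A → ⊩□-intro λ step → ⇒E (⊩□-elim □A⇒B step) (⊩□-elim □A step)
  soundness (K□⁺ {A} {B}) j = ⇒I λ □⁺A⇒B → ⇒I λ □⁺A →
    ⊩□⁺-coinduction (λ k → k ⊩* (A ⇒ B) × k ⊩* A)
      (λ ((a⇒b , _) , (a , _)) → ⇒E a⇒b a)
      (λ ((_ , □⁺A⇒B′) , (_ , □⁺A′)) step → ⊩□⁺-step □⁺A⇒B′ step , ⊩□⁺-step □⁺A′ step)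
      (λ step → ⊩□⁺-step □⁺A⇒B step , ⊩□⁺-step □⁺A step)
  soundness unfold j =
    ⇒I λ □⁺A → ∧I (⊩□-intro (proj₁ ∘ ⊩□⁺-step □⁺A)) (⊩□-intro (proj₂ ∘ ⊩□⁺-step □⁺A))
  soundness (ind {A}) j = ⇒I λ premises →
    ⊩□⁺-coinduction (λ k → k ⊩ A × k ⊩* (A ⇒ □ A))
      proj₁
      (λ (a , (a⇒□a , □⁺inv)) step → ⊩□-elim (⇒E a⇒□a a) step , ⊩□⁺-step □⁺inv step)
      (λ step → ⊩□-elim (∧E₁ premises) step , ⊩□⁺-step (∧E₂ premises) step)
  soundness (mp ⊢A ⊢A⇒B) j = ⇒E (soundness ⊢A⇒B j) (soundness ⊢A j)
  soundness (nec ⊢A) j = ⊩□⁺-coinduction (λ _ → ⊤) (λ {k} _ → soundness ⊢A k) (λ _ _ → tt) (λ _ → tt)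

  ⊩-ω : ∀ {A} (B : ℕ → Fm) → (∀ i {j} → j ⊩ B i ⇒ □ (A ∧' B (suc i))) →
        ∀ {n j} → j ⊩ B n → j ⊩ □⁺ A
  ⊩-ω {A} B premise {n} Bn = ⊩□⁺-coinduction (λ k → k ⊩ A × ∃ λ i → k ⊩ B i)
    proj₁
    (λ (_ , i , Bi) step → successor i Bi step)
    (successor n Bn)
    where
    successor : ∀ i {k m} → k ⊩ B i → Step k m → m ⊩ A × ∃ λ i → m ⊩ B i
    successor i Bi step = let A∧B = ⊩□-elim (⇒E (premise i) Bi) step in ∧E₁ A∧B , suc i , ∧E₂ A∧B

-- The canonical model

infix 4 _≟_

_≟_ : DecidableEquality Fm
var m   ≟ var n   = map′ (cong var) (λ { refl → refl }) (m ≟ℕ n)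
⊥'      ≟ ⊥'      = yes refl
(A ⇒ B) ≟ (C ⇒ D) =
  map′ (λ (p , q) → cong₂ _⇒_ p q) (λ { refl → refl , refl }) (A ≟ C ×-dec B ≟ D)
□ A     ≟ □ B     = map′ (cong □) (λ { refl → refl }) (A ≟ B)
□⁺ A    ≟ □⁺ B    = map′ (cong □⁺) (λ { refl → refl }) (A ≟ B)
var _   ≟ ⊥'      = no λ ()
var _   ≟ _ ⇒ _   = no λ ()
var _   ≟ □ _     = no λ ()
var _   ≟ □⁺ _    = no λ ()
⊥'      ≟ var _   = no λ ()
⊥'      ≟ _ ⇒ _   = no λ ()
⊥'      ≟ □ _     = no λ ()
⊥'      ≟ □⁺ _    = no λ ()
(_ ⇒ _) ≟ var _   = no λ ()
(_ ⇒ _) ≟ ⊥'      = no λ ()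
(_ ⇒ _) ≟ □ _     = no λ ()
(_ ⇒ _) ≟ □⁺ _    = no λ ()
□ _     ≟ var _   = no λ ()
□ _     ≟ ⊥'      = no λ ()
□ _     ≟ _ ⇒ _   = no λ ()
□ _     ≟ □⁺ _    = no λ ()
□⁺ _    ≟ var _   = no λ ()
□⁺ _    ≟ ⊥'      = no λ ()
□⁺ _    ≟ _ ⇒ _   = no λ ()
□⁺ _    ≟ □ _     = no λ ()

cl : Fm → List Fm
cl (var n)  = var n ∷ []
cl ⊥'       = ⊥' ∷ []
cl (A ⇒ B)  = (A ⇒ B) ∷ cl A ++ cl B
cl (□ A)    = □ A ∷ cl A
cl (□⁺ A)   = □⁺ A ∷ □ (□⁺ A) ∷ □ A ∷ cl A

cl-self : ∀ A → A ∈ cl A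
cl-self (var n) = here refl
cl-self ⊥'      = here refl
cl-self (A ⇒ B) = here refl
cl-self (□ A)   = here refl
cl-self (□⁺ A)  = here refl

cl-trans : ∀ A {B} → B ∈ cl A → cl B ⊆ cl A
cl-trans (var n) (here refl) = id
cl-trans ⊥'      (here refl) = id
cl-trans (A ⇒ B) (here refl) = id
cl-trans (□ A)   (here refl) = id
cl-trans (□⁺ A)  (here refl) = id
cl-trans (A ⇒ B) (there C∈) with ∈-++⁻ (cl A) C∈
... | inj₁ C∈A = there ∘ ∈-++⁺ˡ ∘ cl-trans A C∈A
... | inj₂ C∈B = there ∘ ∈-++⁺ʳ (cl A) ∘ cl-trans B C∈B
cl-trans (□ A)   (there C∈) = there ∘ cl-trans A C∈
cl-trans (□⁺ A)  (there (here refl)) (here refl) = there (here refl)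
cl-trans (□⁺ A)  (there (here refl)) (there D∈) = D∈
cl-trans (□⁺ A)  (there (there (here refl))) (here refl) = there (there (here refl))
cl-trans (□⁺ A)  (there (there (here refl))) (there D∈) = there (there (there D∈))
cl-trans (□⁺ A)  (there (there (there C∈))) = there ∘ there ∘ there ∘ cl-trans A C∈

record Closed (L : List Fm) : Set where
  field
    ⇒-closedˡ  : ∀ {A B} → A ⇒ B ∈ L → A ∈ L
    ⇒-closedʳ  : ∀ {A B} → A ⇒ B ∈ L → B ∈ L
    □-closed   : ∀ {A} → □ A ∈ L → A ∈ L
    □⁺-closed  : ∀ {A} → □⁺ A ∈ L → □ A ∈ L
    □⁺-closed′ : ∀ {A} → □⁺ A ∈ L → □ (□⁺ A) ∈ L

cl-closed : ∀ G → Closed (cl G)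
cl-closed G = record
  { ⇒-closedˡ  = λ {A} A⇒B∈ → cl-trans G A⇒B∈ (there (∈-++⁺ˡ (cl-self A)))
  ; ⇒-closedʳ  = λ {A} {B} A⇒B∈ → cl-trans G A⇒B∈ (there (∈-++⁺ʳ (cl A) (cl-self B)))
  ; □-closed   = λ {A} □A∈ → cl-trans G □A∈ (there (cl-self A))
  ; □⁺-closed  = λ □⁺A∈ → cl-trans G □⁺A∈ (there (there (here refl)))
  ; □⁺-closed′ = λ □⁺A∈ → cl-trans G □⁺A∈ (there (here refl))
  }

update : Fm → Bool → (Fm → Bool) → Fm → Bool
update A b f B = if isYes (B ≟ A) then b else f B

update-support : ∀ {A b f B} → T (update A b f B) → B ≡ A ⊎ T (f B)
update-support {A} {B = B} t with B ≟ A
... | yes B≡A = inj₁ B≡A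
... | no  _   = inj₂ t

assignments : List Fm → List (Fm → Bool)
assignments []      = (λ _ → false) ∷ []
assignments (A ∷ L) = map (update A true) (assignments L) ++ map (update A false) (assignments L)

module _ {A : Fm} {L : List Fm} where

  assignments-∷⁺ : ∀ b {g} → g ∈ assignments L → update A b g ∈ assignments (A ∷ L)
  assignments-∷⁺ true  g∈ = ∈-++⁺ˡ (∈-map⁺ (update A true) g∈)
  assignments-∷⁺ false g∈ =
    ∈-++⁺ʳ (map (update A true) (assignments L)) (∈-map⁺ (update A false) g∈)

  assignments-∷⁻ : ∀ {f} → f ∈ assignments (A ∷ L) →
                   ∃ λ b → ∃ λ g → g ∈ assignments L × f ≡ update A b g
  assignments-∷⁻ f∈ with ∈-++⁻ (map (update A true) (assignments L)) f∈
  ... | inj₁ f∈ᵗ = true  , ∈-map⁻ (update A true) f∈ᵗ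
  ... | inj₂ f∈ᶠ = false , ∈-map⁻ (update A false) f∈ᶠ

assignments-support : ∀ L {f B} → f ∈ assignments L → T (f B) → B ∈ L
assignments-support []      (here refl) ()
assignments-support (A ∷ L) {B = B} f∈ fB with assignments-∷⁻ {A} {L} f∈
... | b , g , g∈ , refl with update-support {A} {b} {g} {B} fB
...   | inj₁ refl = here refl
...   | inj₂ gB   = there (assignments-support L g∈ gB)

assignments-realise : ∀ L (e : Fm → Bool) →
                      ∃ λ f → f ∈ assignments L × (∀ {B} → B ∈ L → f B ≡ e B)
assignments-realise []      e = _ , here refl , λ ()
assignments-realise (A ∷ L) e with assignments-realise L e
... | g , g∈ , g≗e = update A (e A) g , assignments-∷⁺ {A} {L} (e A) g∈ , agree
  where
  agree : ∀ {B} → B ∈ A ∷ L → update A (e A) g B ≡ e B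
  agree {B} B∈ with B ≟ A | B∈
  ... | yes refl | _         = refl
  ... | no  B≢A  | here B≡A  = ⊥-elim (B≢A B≡A)
  ... | no  _    | there B∈L = g≗e B∈L

literal : Bool → Fm → Fm
literal true  A = A
literal false A = ¬' A

module _ {ρ : Valuation} where

  literal-value : ∀ {b A} → ρ ⊨ literal b A → value ρ A ≡ b
  literal-value {true}  (holds a) = Equivalence.to T-≡ a
  literal-value {false} ¬a        = ¬T⇒≡false (¬E ¬a ∘ holds)

  ⊨-literal : ∀ {b A} → value ρ A ≡ b → ρ ⊨ literal b A
  ⊨-literal {true}  eq = holds (subst T (sym eq) _)
  ⊨-literal {false} eq = ¬I λ (holds a) → subst T eq a

module Canonical (L : List Fm) (closed : Closed L) where
  open Closed closed
  open ≡-Reasoning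

  N : ℕ
  N = length (assignments L)

  atom : Fin N → Fm → Bool
  atom = lookup (assignments L)

  atom-support : ∀ {j B} → T (atom j B) → B ∈ L
  atom-support {j} = assignments-support L (∈-lookup j)

  atom-realises : (e : Fm → Bool) → ∃ λ j → ∀ {B} → B ∈ L → atom j B ≡ e B
  atom-realises e with assignments-realise L e
  ... | f , f∈ , f≗e =
    index f∈ , λ {B} B∈ → trans (cong (λ g → g B) (sym (lookup-index f∈))) (f≗e B∈)

  χ : Fin N → Fm
  χ j = ⋀ (map (λ B → literal (atom j B) B) L)

  module _ {ρ : Valuation} {j : Fin N} where

    χ-value : ρ ⊨ χ j → ∀ {B} → B ∈ L → value ρ B ≡ atom j B
    χ-value χj B∈ = literal-value (All.lookup (map⁻ (⋀E χj)) B∈)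

    ⊨-χ : (∀ {B} → B ∈ L → value ρ B ≡ atom j B) → ρ ⊨ χ j
    ⊨-χ agree = ⋀I (map⁺ (All.tabulate (⊨-literal ∘ agree)))

  χ⇒ : ∀ {j B} → B ∈ L → T (atom j B) → ⊢ (χ j ⇒ B)
  χ⇒ B∈ b = tautological [] λ _ → ⇒I λ χj → holds (subst T (sym (χ-value χj B∈)) b)

  χ⇒¬ : ∀ {j B} → B ∈ L → ¬ T (atom j B) → ⊢ (χ j ⇒ ¬' B)
  χ⇒¬ B∈ ¬b = tautological [] λ _ → ⇒I λ χj → ¬I λ (holds b) → ¬b (subst T (χ-value χj B∈) b)

  χ-contradiction : ∀ {j B} → B ∈ L → ¬ T (atom j B) → ⊢ (χ j ⇒ B) → ⊢ (¬' (χ j))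
  χ-contradiction B∈ ¬b ⊢χ⇒B = refutation ⊢χ⇒B (χ⇒¬ B∈ ¬b)

  χ-unsatisfiable : ∀ {j} → (∀ {ρ} → ¬ (ρ ⊨ χ j)) → ⊢ (¬' (χ j))
  χ-unsatisfiable unsat = tautological [] λ _ → ¬I unsat

  ⋁χ : (Fin N → Bool) → Fm
  ⋁χ c = ⋁ (map χ (filter (T? ∘ c) (allFin N)))

  ⊨-⋁χ : ∀ {ρ c j} → T (c j) → ρ ⊨ χ j → ρ ⊨ ⋁χ c
  ⊨-⋁χ {j = j} cj χj = ⋁I (lose (∈-map⁺ χ (∈-filter⁺ (T? ∘ _) (∈-allFin j) cj)) χj)

  χ⇒⋁χ : ∀ {c j} → T (c j) → ⊢ (χ j ⇒ ⋁χ c)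
  χ⇒⋁χ cj = tautological [] λ _ → ⇒I (⊨-⋁χ cj)

  ⋁χ-elim : ∀ {c G} → (∀ {j} → T (c j) → ⊢ (χ j ⇒ G)) → ⊢ (⋁χ c ⇒ G)
  ⋁χ-elim {c} ⊢χ⇒G = ⋁-elim {map χ (filter (T? ∘ c) (allFin N))} λ A∈ →
    case ∈-map⁻ χ A∈ of λ where
      (j , j∈ , refl) → ⊢χ⇒G (proj₂ (∈-filter⁻ (T? ∘ c) {xs = allFin N} j∈))

  ⋀⇒⋁χ : ∀ {Bs} → Bs ⊆ L → ⊢ (⋀ Bs ⇒ ⋁χ (λ j → all (atom j) Bs))
  ⋀⇒⋁χ Bs⊆L = tautological [] λ {ρ} _ → ⇒I λ bs → case atom-realises (value ρ) of λ where
    (j , agree) →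
      ⊨-⋁χ (all-intro λ B∈ → subst T (sym (agree (Bs⊆L B∈))) (truth (All.lookup (⋀E bs) B∈)))
           (⊨-χ (sym ∘ agree))

  necessities : Fin N → List Fm
  necessities i = filter (λ B → T? (atom i (□ B))) L

  R : Fin N → Fin N → Bool
  R i j = all (atom j) (necessities i)

  R-□ : ∀ {i j B} → □ B ∈ L → T (atom i (□ B)) → T (R i j) → T (atom j B)
  R-□ {i} □B∈ □b rij = all-elim rij (∈-filter⁺ (λ B → T? (atom i (□ B))) (□-closed □B∈) □b)

  χ⇒□necessities : ∀ i → ⊢ (χ i ⇒ ⋀ (map □ (necessities i)))
  χ⇒□necessities i = tautological [] λ _ → ⇒I λ χi → ⋀I (map⁺ (All.tabulate λ B∈ →
    let □b = proj₂ (∈-filter⁻ (λ B → T? (atom i (□ B))) {xs = L} B∈)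
    in holds (subst T (sym (χ-value χi (atom-support □b))) □b)))

  Refuted : (Fin N → Bool) → Set
  Refuted S = ∀ {j} → ¬ T (S j) → ⊢ (¬' (χ j))

  χ⇒□ : ∀ {S} → Refuted S → ∀ {i G} → (∀ {j} → Frame.Step R S i j → ⊢ (χ j ⇒ G)) →
        ⊢ (χ i ⇒ □ G)
  χ⇒□ {S} refuted {i} {G} step⇒G = ⇒-trans (χ⇒□necessities i)
    (□-regular {necessities i} (⇒-trans (⋀⇒⋁χ necessities⊆L) (⋁χ-elim successor⇒G)))
    where
    necessities⊆L : necessities i ⊆ L
    necessities⊆L = proj₁ ∘ ∈-filter⁻ (λ B → T? (atom i (□ B)))
    successor⇒G : ∀ {j} → T (R i j) → ⊢ (χ j ⇒ G)
    successor⇒G {j} rij with T? (S j)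
    ... | yes sj  = step⇒G (sj , rij)
    ... | no  ¬sj = explosion (refuted ¬sj)

  ⟦_⟧ᵃ : Fm → Fin N → Bool
  ⟦ A ⟧ᵃ k = atom k A

  □⁺-unfolds : Fin N → Fm → Bool
  □⁺-unfolds i A = atom i (□⁺ A) →ᵇ atom i (□ A) ∧ atom i (□ (□⁺ A))

  □⁺-unfolds-refuted : ∀ {i A} → □⁺ A ∈ L → ¬ T (□⁺-unfolds i A) → ⊢ (¬' (χ i))
  □⁺-unfolds-refuted □⁺A∈ ¬unfolds with →ᵇ-counterexample ¬unfolds
  ... | □⁺a , ¬□a∧□□⁺a with ¬T-∧ ¬□a∧□□⁺a
  ...   | inj₁ ¬□a   = χ-contradiction (□⁺-closed □⁺A∈) ¬□a (⇒-trans (χ⇒ □⁺A∈ □⁺a) □⁺⇒□)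
  ...   | inj₂ ¬□□⁺a = χ-contradiction (□⁺-closed′ □⁺A∈) ¬□□⁺a (⇒-trans (χ⇒ □⁺A∈ □⁺a) □⁺⇒□□⁺)

  module Coherence (S : Fin N → Bool) where
    open Frame R S

    □-witnessed : Fin N → Fm → Bool
    □-witnessed i A = atom i (□ A) ∨ not (□[ ⟦ A ⟧ᵃ ] i)

    □⁺-witnessed : Fin N → Fm → Bool
    □⁺-witnessed i A = atom i (□⁺ A) ∨ not (□[ □*[ ⟦ A ⟧ᵃ ] ] i)

    coherent-at : Fin N → Fm → Bool
    coherent-at i (var _) = true
    coherent-at i ⊥'      = not (atom i ⊥')
    coherent-at i (A ⇒ B) = isYes (atom i (A ⇒ B) ≟ᵇ (atom i A →ᵇ atom i B))
    coherent-at i (□ A)   = □-witnessed i A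
    coherent-at i (□⁺ A)  = □⁺-unfolds i A ∧ □⁺-witnessed i A

    coherent : Fin N → Bool
    coherent i = all (coherent-at i) L

    module _ (refuted : Refuted S) {i : Fin N} where

      □-witnessed-refuted : ∀ {A} → □ A ∈ L → ¬ T (□-witnessed i A) → ⊢ (¬' (χ i))
      □-witnessed-refuted □A∈ ¬witnessed with ¬T-∨ ¬witnessed
      ... | ¬□a , ¬¬□[a] =
        χ-contradiction □A∈ ¬□a
          (χ⇒□ refuted λ step → χ⇒ (□-closed □A∈) (□-elim (¬T-not ¬¬□[a]) step))

      □⁺-witnessed-refuted : ∀ {A} → □⁺ A ∈ L → ¬ T (□⁺-witnessed i A) → ⊢ (¬' (χ i))
      □⁺-witnessed-refuted {A} □⁺A∈ ¬witnessed with ¬T-∨ ¬witnessed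
      ... | ¬□⁺a , ¬¬□[□*a] =
        χ-contradiction □⁺A∈ ¬□⁺a
          (⇒-trans (χ⇒□ refuted λ step → χ⇒⋁χ (□-elim (¬T-not ¬¬□[□*a]) step)) (□⁺-induction I⇒A I⇒□I))
        where
        I : Fm
        I = ⋁χ □*[ ⟦ A ⟧ᵃ ]
        I⇒A : ⊢ (I ⇒ A)
        I⇒A = ⋁χ-elim λ k∈ → χ⇒ (□-closed (□⁺-closed □⁺A∈)) (proj₂ (□*-now k∈))
        I⇒□I : ⊢ (I ⇒ □ I)
        I⇒□I = ⋁χ-elim λ k∈ → χ⇒□ refuted λ step → χ⇒⋁χ (□*-next k∈ step)

      incoherent-refuted : ∀ {A} → A ∈ L → ¬ T (coherent-at i A) → ⊢ (¬' (χ i))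
      incoherent-refuted {var _} _ ¬c = ⊥-elim (¬c _)
      incoherent-refuted {⊥'} ⊥∈ ¬c = χ⇒ ⊥∈ (¬T-not ¬c)
      incoherent-refuted {A ⇒ B} A⇒B∈ ¬c = χ-unsatisfiable λ {ρ} χi → ¬c (fromWitness (begin
        atom i (A ⇒ B)         ≡⟨ sym (χ-value χi A⇒B∈) ⟩
        value ρ (A ⇒ B)        ≡⟨ value-⇒ ρ A B ⟩
        value ρ A →ᵇ value ρ B ≡⟨ cong₂ _→ᵇ_ (χ-value χi (⇒-closedˡ A⇒B∈))
                                            (χ-value χi (⇒-closedʳ A⇒B∈)) ⟩
        atom i A →ᵇ atom i B   ∎))
      incoherent-refuted {□ A} □A∈ ¬c = □-witnessed-refuted □A∈ ¬c
      incoherent-refuted {□⁺ A} □⁺A∈ ¬c with ¬T-∧ ¬c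
      ... | inj₁ ¬unfolds   = □⁺-unfolds-refuted □⁺A∈ ¬unfolds
      ... | inj₂ ¬witnessed = □⁺-witnessed-refuted □⁺A∈ ¬witnessed

  open Coherence using (coherent; coherent-at; incoherent-refuted)

  live : Fin N → Bool
  live = survivors (λ _ → true)
    where open Iterated-deletion coherent

  live-refuted : Refuted live
  live-refuted = survivors-invariant Refuted shrink-refuted (λ ¬true → ⊥-elim (¬true _))
    where
    open Iterated-deletion coherent
    shrink-refuted : ∀ {C} → Refuted C → Refuted (shrink C)
    shrink-refuted {C} refuted {j} ¬shrunk with ¬T-∧ ¬shrunk
    ... | inj₁ ¬cj       = refuted ¬cj
    ... | inj₂ ¬coherent with all-counterexample ¬coherent
    ...   | A , A∈ , ¬cA = incoherent-refuted C refuted A∈ ¬cA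

  live-coherent : ∀ {j A} → T (live j) → A ∈ L → T (coherent-at live j A)
  live-coherent lj = all-elim (survivors-post-fixed (λ _ → true) lj)
    where open Iterated-deletion coherent

  open Model (λ j n → atom j (var n)) R live public

  live-□⁺-step : ∀ {j k A} → □⁺ A ∈ L → T (live j) → T (atom j (□⁺ A)) → Step j k →
                 T (atom k A) × T (atom k (□⁺ A))
  live-□⁺-step □⁺A∈ lj □⁺a (_ , rjk)
    with Equivalence.to T-∧ (→ᵇ-elim (proj₁ (Equivalence.to T-∧ (live-coherent lj □⁺A∈))) □⁺a)
  ... | □a , □□⁺a = R-□ (□⁺-closed □⁺A∈) □a rjk , R-□ (□⁺-closed′ □⁺A∈) □□⁺a rjk

  Truthful : Fm → Set
  Truthful A = ∀ {j} → T (live j) → Sat j A ≡ atom j A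

  truthful-□ : ∀ {A} → □ A ∈ L → Truthful A → Truthful (□ A)
  truthful-□ {A} □A∈ IH {j} lj = T-injective sat⇒atom atom⇒sat
    where
    sat⇒atom : T (Sat j (□ A)) → T (atom j (□ A))
    sat⇒atom □A with Equivalence.to T-∨ (live-coherent lj □A∈)
    ... | inj₁ □a    = □a
    ... | inj₂ ¬□[a] =
      ⊥-elim (T-not ¬□[a] (□-intro λ step → subst T (IH (proj₁ step)) (□-elim □A step)))
    atom⇒sat : T (atom j (□ A)) → T (Sat j (□ A))
    atom⇒sat □a = □-intro λ (lk , rjk) → subst T (sym (IH lk)) (R-□ □A∈ □a rjk)

  truthful-□⁺ : ∀ {A} → □⁺ A ∈ L → Truthful A → Truthful (□⁺ A)
  truthful-□⁺ {A} □⁺A∈ IH {j} lj = T-injective sat⇒atom atom⇒sat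
    where
    sat⇒atom : T (Sat j (□⁺ A)) → T (atom j (□⁺ A))
    sat⇒atom □⁺A with Equivalence.to T-∨ (proj₂ (Equivalence.to T-∧ (live-coherent lj □⁺A∈)))
    ... | inj₁ □⁺a     = □⁺a
    ... | inj₂ ¬□[□*a] = ⊥-elim (T-not ¬□[□*a] (□-intro λ step →
      □*-coinduction (λ k → T (□*[ (λ k → Sat k A) ] k))
        (λ k∈ → let lk , ak = □*-now k∈ in lk , subst T (IH lk) ak)
        □*-next (□-elim □⁺A step)))
    atom⇒sat : T (atom j (□⁺ A)) → T (Sat j (□⁺ A))
    atom⇒sat □⁺a = □-intro λ step →
      □*-coinduction (λ k → T (live k) × T (atom k A) × T (atom k (□⁺ A)))
        (λ (lk , ak , _) → lk , subst T (sym (IH lk)) ak)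
        (λ (lk , _ , □⁺ak) step′ → proj₁ step′ , live-□⁺-step □⁺A∈ lk □⁺ak step′)
        (proj₁ step , live-□⁺-step □⁺A∈ lj □⁺a step)

  truth-lemma : ∀ {A} → A ∈ L → Truthful A
  truth-lemma {var n}  _    _  = refl
  truth-lemma {⊥'}     ⊥∈   lj = sym (Equivalence.to T-not-≡ (live-coherent lj ⊥∈))
  truth-lemma {A ⇒ B}  A⇒B∈ {j} lj = begin
    Sat j A →ᵇ Sat j B   ≡⟨ cong₂ _→ᵇ_ (truth-lemma (⇒-closedˡ A⇒B∈) lj)
                                      (truth-lemma (⇒-closedʳ A⇒B∈) lj) ⟩
    atom j A →ᵇ atom j B ≡⟨ sym (toWitness (live-coherent lj A⇒B∈)) ⟩
    atom j (A ⇒ B)       ∎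
  truth-lemma {□ A}    □A∈  = truthful-□ □A∈ (truth-lemma (□-closed □A∈))
  truth-lemma {□⁺ A}   □⁺A∈ = truthful-□⁺ □⁺A∈ (truth-lemma (□-closed (□⁺-closed □⁺A∈)))

  completeness : ∀ {G} → G ∈ L → (∀ j → j ⊩ G) → ⊢ G
  completeness {G} G∈ valid =
    tautological (⋀⇒⋁χ {[]} (λ ()) ∷ ⋁χ-elim (λ {j} _ → χ⇒G j) ∷ []) λ where
      (⊤⇒⋁χ ∷ ⋁χ⇒G ∷ []) → ⇒E ⋁χ⇒G (⇒E ⊤⇒⋁χ (⋀I []))
    where
    χ⇒G : ∀ j → ⊢ (χ j ⇒ G)
    χ⇒G j with T? (live j)
    ... | yes lj  = χ⇒ G∈ (subst T (truth-lemma G∈ lj) (truth (valid j)))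
    ... | no  ¬lj = explosion (live-refuted ¬lj)

corollary29 : (A : Fm) (B : ℕ → Fm) →
    ((i : ℕ) → ⊢ (B i ⇒ □ (A ∧' B (suc i)))) →
    ⊢ (B 0 ⇒ □⁺ A)
corollary29 A B premise = completeness (cl-self G) λ j → ⇒I (⊩-ω B (λ i {k} → soundness (premise i) k))
  where
  G : Fm
  G = B 0 ⇒ □⁺ A
  open Canonical (cl G) (cl-closed G)
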